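{- Let $\mathcal{C}$ be a univalent wild bicategory with an orthogonal factorization system $(\mathcal{L},\mathcal{R})$. Consider a commuting square with: - $f:\mathsf{hom}(A,X)$, - $l:\mathsf{hom}(A,B)$, - $r:\mathsf{hom}(X,Y)$, - $g:\mathsf{hom}(B,Y)$, - $S:g\circ l=r\circ f$. If $l\in\mathcal{L}$ and $r\in\mathcal{R}$, then the type $\mathsf{fill}(S)$ of diagonal fillers is contractible.
   Context: Wild categories. A wild category consists of objects, hom-types, composition, identities and identifications $\mathsf{Rid}(f):f\circ\mathsf{id}=f$, $\mathsf{Lid}(f):\mathsf{id}\circ f=f$ and $\mathsf{assoc}(h,g,f):(h\circ g)\circ f=h\circ(g\circ f)$. Bicategories. A wild bicategory further satisfies: - the pentagon identity $$\mathsf{ap}_{ -\circ f}(\mathsf{assoc}(k,g,h))\cdot\mathsf{assoc}(k,g\circ h,f)\cdot\mathsf{ap}_{k\circ- }(\mathsf{assoc}(g,h,f))=\mathsf{assoc}(k\circ g,h,f)\cdot\mathsf{assoc}(k,g,h\circ f);$$ - the triangle identity $$\mathsf{assoc}(g,\mathsf{id},h)\cdot\mathsf{ap}_{g\circ- }(\mathsf{Lid}(h))=\mathsf{ap}_{ -\circ h}(\mathsf{Rid}(g)).$$ Univalence. The wild category is univalent if the canonical map from identifications of objects to bi-invertible morphisms is an equivalence. Orthogonal factorization systems. An OFS $(\mathcal{L},\mathcal{R})$ consists of two proposition-valued predicates on morphisms such that: - both contain identities and are closed under composition; - for every $h$, the type of factorizations $\sum_D\sum_f\sum_g (g\circ f=h)\times\mathcal{L}(f)\times\mathcal{R}(g)$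 is contractible. Fillers. For the square above, $$\mathsf{fill}(S):=\sum_{d:\mathsf{hom}(B,X)}\ \sum_{H_f:d\circ l=f}\ \sum_{H_g:r\circ d=g}\ \mathsf{assoc}(r,d,l)\cdot\mathsf{ap}_{r\circ- }(H_f)=\mathsf{ap}_{ -\circ l}(H_g)\cdot S.$$ -}

module Defs where

open import Level using (Level; _⊔_; suc)
open import Data.Product using (Σ; Σ-syntax; _×_; _,_)
open import Relation.Binary.PropositionalEquality using (_≡_; refl; trans; cong)

isContr : ∀ {a} → Set a → Set a
isContr A = Σ A λ c → ∀ x → c ≡ x

isProp : ∀ {a} → Set a → Set a
isProp A = (x y : A) → x ≡ y

isEquiv : ∀ {a b} {A : Set a} {B : Set b} → (A → B) → Set (a ⊔ b)
isEquiv {A = A} {B} f =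
  (Σ[ g ∈ (B → A) ] (∀ x → g (f x) ≡ x)) × (Σ[ h ∈ (B → A) ] (∀ y → f (h y) ≡ y))

record WildCat (o h : Level) : Set (suc (o ⊔ h)) where
  infixr 9 _∘_
  field
    Ob    : Set o
    hom   : Ob → Ob → Set h
    _∘_   : ∀ {a b c} → hom b c → hom a b → hom a c
    id    : ∀ {a} → hom a a
    Rid   : ∀ {a b} (f : hom a b) → f ∘ id ≡ f
    Lid   : ∀ {a b} (f : hom a b) → id ∘ f ≡ f
    assoc : ∀ {a b c d} (h : hom c d) (g : hom b c) (f : hom a b) →
            (h ∘ g) ∘ f ≡ h ∘ (g ∘ f)

  isBiInv : ∀ {a b} → hom a b → Set h
  isBiInv {a} {b} f =
    (Σ[ g ∈ hom b a ] (g ∘ f ≡ id)) × (Σ[ k ∈ hom b a ] (f ∘ k ≡ id))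

  BiInv : Ob → Ob → Set h
  BiInv a b = Σ[ f ∈ hom a b ] isBiInv f

  idBiInv : ∀ {a} → BiInv a a
  idBiInv = id , (id , Lid id) , (id , Lid id)

  idtoiso : ∀ {a b} → a ≡ b → BiInv a b
  idtoiso refl = idBiInv

record IsWildBicat {o h} (C : WildCat o h) : Set (o ⊔ h) where
  open WildCat C
  field
    pentagon : ∀ {a b c d e} (k : hom d e) (g : hom c d) (h : hom b c) (f : hom a b) →
      trans (cong (_∘ f) (assoc k g h))
            (trans (assoc k (g ∘ h) f) (cong (k ∘_) (assoc g h f)))
      ≡ trans (assoc (k ∘ g) h f) (assoc k g (h ∘ f))
    triangle : ∀ {a b c} (g : hom b c) (h : hom a b) →
      trans (assoc g id h) (cong (g ∘_) (Lid h)) ≡ cong (_∘ h) (Rid g)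

isUnivalent : ∀ {o h} (C : WildCat o h) → Set (o ⊔ h)
isUnivalent C = ∀ a b → isEquiv (idtoiso {a} {b})
  where open WildCat C

record OFS {o h} (C : WildCat o h) (p : Level) : Set (o ⊔ h ⊔ suc p) where
  open WildCat C
  field
    L R      : ∀ {a b} → hom a b → Set p
    L-prop   : ∀ {a b} (f : hom a b) → isProp (L f)
    R-prop   : ∀ {a b} (f : hom a b) → isProp (R f)
    L-id     : ∀ {a} → L (id {a})
    R-id     : ∀ {a} → R (id {a})
    L-comp   : ∀ {a b c} {g : hom b c} {f : hom a b} → L g → L f → L (g ∘ f)
    R-comp   : ∀ {a b c} {g : hom b c} {f : hom a b} → R g → R f → R (g ∘ f)
    factor   : ∀ {a b} (k : hom a b) →
      isContr (Σ[ D ∈ Ob ] Σ[ f ∈ hom a D ] Σ[ g ∈ hom D b ]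
                 ((g ∘ f ≡ k) × L f × R g))

fill : ∀ {o h} (C : WildCat o h) → let open WildCat C in
  ∀ {A B X Y : Ob} {f : hom A X} {l : hom A B} {r : hom X Y} {g : hom B Y} →
  g ∘ l ≡ r ∘ f → Set h
fill C {A} {B} {X} {Y} {f} {l} {r} {g} S =
  Σ[ d ∈ hom B X ] Σ[ Hf ∈ d ∘ l ≡ f ] Σ[ Hg ∈ r ∘ d ≡ g ]
    (trans (assoc r d l) (cong (r ∘_) Hf) ≡ trans (cong (_∘ l) Hg) S)
  where open WildCat C

-- A filler of S is a point of the fibre over (g , S) of postcomposition with r, viewed as a map
-- from extensions of f along l (d with d ∘ l ≡ f) to extensions of r ∘ f along l, so it suffices
-- that this map have contractible fibres. Factoring the extending morphism uniquely as an R-map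
-- after an L-map u out of B identifies both extension types with sums, over such u, of
-- R-extensions along u ∘ l (again an L-map); the pentagon makes postcomposition with r
-- correspond to postcomposing these R-extensions. Finally, for an L-map a out of A,
-- postcomposing R-extensions along a with r is a fibre of a map between the contractible types
-- of (L, R)-factorizations of f and of r ∘ f, so it has contractible fibres.
module Submission where

open import Level using (Level; _⊔_)
open import Function.Base using (_∘′_)
open import Data.Product using (Σ; Σ-syntax; _×_; _,_; proj₁; proj₂; map₂)
open import Relation.Binary.PropositionalEquality
  using (_≡_; refl; trans; sym; cong; module ≡-Reasoning)
open import Relation.Binary.PropositionalEquality.Properties
  using (trans-assoc; trans-symˡ; trans-cong)
open import Defs

private variable
  a b c : Level
  A : Set a
  B : Set b
  C : Set c

fiber : (A → B) → B → Set _
fiber {A = A} f y = Σ[ x ∈ A ] f x ≡ y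

isContrMap : (A → B) → Set _
isContrMap f = ∀ y → isContr (fiber f y)

isContr-retract : (s : B → A) (r : A → B) → (∀ x → r (s x) ≡ x) → isContr A → isContr B
isContr-retract s r r∘s≡id (c , h) = r c , λ x → trans (cong r (h (s x))) (r∘s≡id x)

isContr-Σ : {P : A → Set b} → isContr A → (∀ x → isContr (P x)) → isContr (Σ A P)
isContr-Σ {P = P} (c , h) isContr-P = (c , centre c) , λ (x , y) → to (h x) y
  where
  centre : ∀ x → P x
  centre x = proj₁ (isContr-P x)
  to : ∀ {x} → c ≡ x → (y : P x) → (c , centre c) ≡ (x , y)
  to refl y = cong (c ,_) (proj₂ (isContr-P c) y)

isContr-≡ : isContr A → (x y : A) → isContr (x ≡ y)
isContr-≡ (c , h) x y = trans (sym (h x)) (h y) , contraction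
  where
  contraction : ∀ {y} (p : x ≡ y) → trans (sym (h x)) (h y) ≡ p
  contraction refl = trans-symˡ (h x)

isContr⇒isContrMap : isContr A → isContr B → (f : A → B) → isContrMap f
isContr⇒isContrMap isContr-A isContr-B f y =
  isContr-Σ isContr-A (λ x → isContr-≡ isContr-B (f x) y)

isContrMap-∘ : {g : B → C} {f : A → B} → isContrMap g → isContrMap f → isContrMap (g ∘′ f)
isContrMap-∘ {g = g} {f} isContrMap-g isContrMap-f z =
  isContr-retract to from (λ _ → refl)
    (isContr-Σ (isContrMap-g z) (λ (y , _) → isContrMap-f y))
  where
  to : fiber (g ∘′ f) z → Σ[ (y , _) ∈ fiber g z ] fiber f y
  to (x , p) = (f x , p) , (x , refl)
  from : Σ[ (y , _) ∈ fiber g z ] fiber f y → fiber (g ∘′ f) z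
  from ((y , q) , (x , p)) = x , trans (cong g p) q

isContrMap-cancelʳ : {g : B → C} {f : A → B} →
  isContrMap f → isContrMap (g ∘′ f) → isContrMap g
isContrMap-cancelʳ {g = g} {f} isContrMap-f isContrMap-g∘f z =
  isContr-retract to from from∘to (isContrMap-g∘f z)
  where
  section : ∀ y → fiber f y
  section y = proj₁ (isContrMap-f y)
  to : fiber g z → fiber (g ∘′ f) z
  to (y , q) = proj₁ (section y) , trans (cong g (proj₂ (section y))) q
  from : fiber (g ∘′ f) z → fiber g z
  from (x , p) = f x , p
  slide : ∀ {y y′} (p : y ≡ y′) (q : g y′ ≡ z) → _≡_ {A = fiber g z} (y , trans (cong g p) q) (y′ , q)
  slide refl q = refl
  from∘to : ∀ w → from (to w) ≡ w
  from∘to (y , q) = slide (proj₂ (section y)) q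

isContrMap-homotopic : {f g : A → B} → (∀ x → f x ≡ g x) → isContrMap g → isContrMap f
isContrMap-homotopic {f = f} {g} f≗g isContrMap-g y =
  isContr-retract to from from∘to (isContrMap-g y)
  where
  to : fiber f y → fiber g y
  to (x , p) = x , trans (sym (f≗g x)) p
  from : fiber g y → fiber f y
  from (x , q) = x , trans (f≗g x) q
  cancel : ∀ {u v w : B} (e : u ≡ v) (p : u ≡ w) → trans e (trans (sym e) p) ≡ p
  cancel refl p = refl
  from∘to : ∀ w → from (to w) ≡ w
  from∘to (x , p) = cong (x ,_) (cancel (f≗g x) p)

trans-isContrMap : {x y z : A} (e : x ≡ y) → isContrMap (λ (p : y ≡ z) → trans e p)
trans-isContrMap refl q = (q , refl) , λ { (_ , refl) → refl }

module _ {P : A → Set b} {Q : A → Set c} (φ : ∀ {x} → P x → Q x) where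

  total : Σ A P → Σ A Q
  total = map₂ {B = P} {C = Q} φ

  private
    to-total : ∀ {x z} → fiber (φ {x}) z → fiber total (x , z)
    to-total {x} (y , q) = (x , y) , cong (x ,_) q

    from-total : ∀ {x z} → fiber total (x , z) → fiber (φ {x}) z
    from-total ((_ , y) , refl) = y , refl

    from∘to-total : ∀ {x z} (w : fiber (φ {x}) z) → from-total (to-total w) ≡ w
    from∘to-total (_ , refl) = refl

    to∘from-total : ∀ {x z} (w : fiber total (x , z)) → to-total (from-total w) ≡ w
    to∘from-total (_ , refl) = refl

  total-isContrMap : (∀ x → isContrMap (φ {x})) → isContrMap total
  total-isContrMap isContrMap-φ (x , z) =
    isContr-retract from-total to-total to∘from-total (isContrMap-φ x z)

  fiberwise-isContrMap : isContrMap total → ∀ x → isContrMap (φ {x})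
  fiberwise-isContrMap isContrMap-total x z =
    isContr-retract to-total from-total from∘to-total (isContrMap-total (x , z))

module _ {o h : Level} (𝒞 : WildCat o h) where
  open WildCat 𝒞

  Extension : ∀ {a e b} → hom a e → hom a b → Set h
  Extension {e = e} {b} u k = Σ[ d ∈ hom e b ] d ∘ u ≡ k

  postcompose : ∀ {a e b c} {u : hom a e} {k : hom a b} (r : hom b c) →
    Extension u k → Extension u (r ∘ k)
  postcompose {u = u} r (d , H) = r ∘ d , trans (assoc r d u) (cong (r ∘_) H)

  Extension-≡ : ∀ {a e b} {u : hom a e} {k : hom a b} {d d′ : hom e b}
    {H : d ∘ u ≡ k} {H′ : d′ ∘ u ≡ k} (p : d′ ≡ d) →
    H′ ≡ trans (cong (_∘ u) p) H → _≡_ {A = Extension u k} (d , H) (d′ , H′)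
  Extension-≡ refl refl = refl

  isContr-fiber⇒isContr-fill : ∀ {a b x y} {f : hom a x} {l : hom a b} {r : hom x y}
    {g : hom b y} (S : g ∘ l ≡ r ∘ f) →
    isContr (fiber (postcompose r) (g , S)) → isContr (fill 𝒞 S)
  isContr-fiber⇒isContr-fill {f = f} {l} {r} S =
    isContr-retract (to S) (from S) (from∘to S)
    where
    to : ∀ {g} (S : g ∘ l ≡ r ∘ f) → fill 𝒞 S → fiber (postcompose r) (g , S)
    to _ (d , Hf , refl , refl) = (d , Hf) , refl
    from : ∀ {g} (S : g ∘ l ≡ r ∘ f) → fiber (postcompose r) (g , S) → fill 𝒞 S
    from _ ((d , Hf) , refl) = d , Hf , refl , refl
    from∘to : ∀ {g} (S : g ∘ l ≡ r ∘ f) (x : fill 𝒞 S) → from S (to S x) ≡ x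
    from∘to _ (d , Hf , refl , refl) = refl

  module _ {p : Level} (F : OFS 𝒞 p) where
    open OFS F

    LMapFrom : Ob → Set (o ⊔ h ⊔ p)
    LMapFrom a = Σ[ E ∈ Ob ] Σ[ u ∈ hom a E ] L u

    arr : ∀ {a} (e : LMapFrom a) → hom a (proj₁ e)
    arr e = proj₁ (proj₂ e)

    RMap : Ob → Ob → Set (h ⊔ p)
    RMap e b = Σ (hom e b) R

    RExtension : ∀ {a e b} → hom a e → hom a b → Set (h ⊔ p)
    RExtension {e = e} {b} u k = Σ[ v ∈ RMap e b ] proj₁ v ∘ u ≡ k

    Factorization : ∀ {a b} → hom a b → Set (o ⊔ h ⊔ p)
    Factorization {a} k = Σ[ e ∈ LMapFrom a ] RExtension (arr e) k

    Factorization-isContr : ∀ {a b} (k : hom a b) → isContr (Factorization k)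
    Factorization-isContr {a} {b} k = isContr-retract to from (λ _ → refl) (factor k)
      where
      to : Factorization k →
        Σ[ E ∈ Ob ] Σ[ u ∈ hom a E ] Σ[ v ∈ hom E b ] ((v ∘ u ≡ k) × L u × R v)
      to ((E , u , Lu) , (v , Rv) , H) = E , u , v , H , Lu , Rv
      from : Σ[ E ∈ Ob ] Σ[ u ∈ hom a E ] Σ[ v ∈ hom E b ] ((v ∘ u ≡ k) × L u × R v) →
        Factorization k
      from (E , u , v , H , Lu , Rv) = (E , u , Lu) , (v , Rv) , H

    composite : ∀ {a b t} {T : hom a b → Set t} →
      Σ[ e ∈ LMapFrom a ] Σ[ v ∈ RMap (proj₁ e) b ] T (proj₁ v ∘ arr e) → Σ (hom a b) T
    composite ((_ , u , _) , (v , _) , t) = v ∘ u , t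

    composite-isContrMap : ∀ {a b t} {T : hom a b → Set t} → isContrMap (composite {T = T})
    composite-isContrMap {T = T} (k , t) =
      isContr-retract to (from t) from∘to (Factorization-isContr k)
      where
      to : ∀ {k t} → fiber (composite {T = T}) (k , t) → Factorization k
      to ((e , v , _) , q) = e , v , cong proj₁ q
      from : ∀ {k} (t : T k) → Factorization k → fiber composite (k , t)
      from t (e , v , refl) = (e , v , t) , refl
      from∘to : ∀ {k t} (x : fiber (composite {T = T}) (k , t)) → from t (to x) ≡ x
      from∘to (_ , refl) = refl

    compositeAlong : ∀ {a b z} (l : hom a b) (k : hom a z) →
      Σ[ e ∈ LMapFrom b ] RExtension (arr e ∘ l) k → Extension l k
    compositeAlong l k ((_ , u , _) , (v , _) , H) = v ∘ u , trans (assoc v u l) H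

    compositeAlong-isContrMap : ∀ {a b z} (l : hom a b) (k : hom a z) →
      isContrMap (compositeAlong l k)
    compositeAlong-isContrMap l k =
      -- compositeAlong l k is definitionally composite after reassociating v ∘ (u ∘ l) ≡ k.
      isContrMap-∘ composite-isContrMap
        (total-isContrMap _ λ _ → total-isContrMap _ λ (v , _) → trans-isContrMap (assoc v _ l))

    postcomposeR : ∀ {a e b c} {u : hom a e} {k : hom a b} {r : hom b c} →
      R r → RExtension u k → RExtension u (r ∘ k)
    postcomposeR {u = u} {r = r} Rr ((v , Rv) , H) =
      (r ∘ v , R-comp Rr Rv) , trans (assoc r v u) (cong (r ∘_) H)

    postcomposeR-isContrMap : ∀ {a e b c} {u : hom a e} {k : hom a b} {r : hom b c} →
      L u → (Rr : R r) → isContrMap (postcomposeR {u = u} {k} Rr)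
    postcomposeR-isContrMap {u = u} {k} {r} Lu Rr =
      fiberwise-isContrMap {P = λ e → RExtension (arr e) k} (postcomposeR Rr)
        (isContr⇒isContrMap (Factorization-isContr k) (Factorization-isContr (r ∘ k)) _)
        (_ , u , Lu)

    module _ (bicat : IsWildBicat 𝒞) where
      open IsWildBicat bicat

      postcompose-compositeAlong : ∀ {a b x y} {l : hom a b} {f : hom a x} {r : hom x y}
        (Rr : R r) (w : Σ[ e ∈ LMapFrom b ] RExtension (arr e ∘ l) f) →
        postcompose r (compositeAlong l f w) ≡ compositeAlong l (r ∘ f) (total (postcomposeR Rr) w)
      postcompose-compositeAlong {l = l} {r = r} _ ((_ , u , _) , (v , _) , H) =
        Extension-≡ (assoc r v u) (begin
          trans (assoc (r ∘ v) u l) (trans (assoc r v (u ∘ l)) (cong (r ∘_) H))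
            ≡⟨ sym (trans-assoc (assoc (r ∘ v) u l)) ⟩
          trans (trans (assoc (r ∘ v) u l) (assoc r v (u ∘ l))) (cong (r ∘_) H)
            ≡⟨ cong (λ q → trans q (cong (r ∘_) H)) (sym (pentagon r v u l)) ⟩
          trans (trans α (trans β (cong (r ∘_) δ))) (cong (r ∘_) H)
            ≡⟨ trans-assoc α ⟩
          trans α (trans (trans β (cong (r ∘_) δ)) (cong (r ∘_) H))
            ≡⟨ cong (trans α) (trans-assoc β) ⟩
          trans α (trans β (trans (cong (r ∘_) δ) (cong (r ∘_) H)))
            ≡⟨ cong (λ q → trans α (trans β q)) (trans-cong δ) ⟩
          trans α (trans β (cong (r ∘_) (trans δ H)))
            ∎)
        where
        open ≡-Reasoning
        α = cong (_∘ l) (assoc r v u)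
        β = assoc r (v ∘ u) l
        δ = assoc v u l

      postcompose-isContrMap : ∀ {a b x y} {l : hom a b} {f : hom a x} {r : hom x y} →
        L l → R r → isContrMap (postcompose {u = l} {k = f} r)
      postcompose-isContrMap {l = l} {f} {r} Ll Rr =
        isContrMap-cancelʳ (compositeAlong-isContrMap l f)
          (isContrMap-homotopic (postcompose-compositeAlong Rr)
            (isContrMap-∘ (compositeAlong-isContrMap l (r ∘ f))
              (total-isContrMap _ λ (_ , _ , Lu) → postcomposeR-isContrMap (L-comp Lu Ll) Rr)))

mainTheorem7 : ∀ {o h p : Level} (C : WildCat o h) → IsWildBicat C → isUnivalent C →
    (F : OFS C p) →
    ∀ {A B X Y : WildCat.Ob C}
      (f : WildCat.hom C A X) (l : WildCat.hom C A B)
      (r : WildCat.hom C X Y) (g : WildCat.hom C B Y)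
      (S : WildCat._∘_ C g l ≡ WildCat._∘_ C r f) →
      OFS.L F l → OFS.R F r → isContr (fill C S)
mainTheorem7 C bicat _ F f l r g S Ll Rr =
  isContr-fiber⇒isContr-fill C S (postcompose-isContrMap C F bicat Ll Rr (g , S))
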